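{- For any positive integers $k$ and $q$ with $q\ge2$ (and $k\ge 2$), no two distinct points of $D_{q,k}$ are scalar multiples of each other.
   Context: $X_{q,k}=\prod_{j=1}^{k-1}(q^{k+j}+q^{k-j}+1)$, and $D_{q,k}\subseteq\mathbb{Z}^2$ consists of the points $\frac{X_{q,k}}{q^{k+j}+q^{k-j}+1}(q^{k+j}-q^{k-j},\,-q^j-2q^k)$ for $j=1,\dots,k-1$. -}

module Defs where

open import Data.Nat using (ℕ; zero; suc; _+_; _*_; _∸_; _^_)
open import Data.Nat.DivMod using (_/_)
open import Data.List using (List; map; upTo)
open import Data.Nat.ListAction using (product)
open import Data.Integer as ℤ using (ℤ; +_)
open import Data.Product using (_×_; _,_)

-- the factor  q^(k+j) + q^(k-j) + 1  (written as suc so it is visibly nonzero)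
factor : ℕ → ℕ → ℕ → ℕ
factor q k j = suc (q ^ (k + j) + q ^ (k ∸ j))

-- X_{q,k} = ∏_{j=1}^{k-1} (q^(k+j) + q^(k-j) + 1)
-- upTo (k ∸ 1) = [0, …, k-2], so j = i+1 ranges over 1 … k-1
X : ℕ → ℕ → ℕ
X q k = product (map (λ i → factor q k (suc i)) (upTo (k ∸ 1)))

-- the j-th point of D_{q,k}:
--   X/(q^(k+j)+q^(k-j)+1) · (q^(k+j) - q^(k-j), -q^j - 2q^k)
-- (the division is exact since the factor divides X for 1 ≤ j ≤ k-1)
point : ℕ → ℕ → ℕ → ℤ × ℤ
point q k j =
  let c = X q k / factor q k j in
  ( + c ℤ.* (+ (q ^ (k + j)) ℤ.- + (q ^ (k ∸ j)))
  , + c ℤ.* (ℤ.- (+ (q ^ j)) ℤ.- + (2 * q ^ k)) )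

{-# OPTIONS --safe #-}
-- The j-th point is the positive multiple X/(q^(k+j) + q^(k−j) + 1) of the direction
-- d_j = (q^(k+j) − q^(k−j), −q^j − 2q^k), so two points are proportional exactly when
-- d_i and d_j are. With T = 2q^k and i < j, this would mean
-- (q^(k+i) − q^(k−i))(q^j + T) = (q^(k+j) − q^(k−j))(q^i + T). The products q^(k+i) q^j and
-- q^(k+j) q^i agree, but T q^(k+i) < T q^(k+j) while q^(k−j)(q^i + T) ≤ q^(k−i)(q^j + T),
-- so the right-hand side is strictly larger.
module Submission where

open import Defs
open import Data.Nat using (ℕ; _≤_; _<_)
open import Data.Integer using (ℤ)
open import Data.Rational using (ℚ; _*_; _/_)
open import Data.Product using (_×_; _,_; ∃-syntax; proj₁; proj₂)
open import Relation.Binary.PropositionalEquality using (_≡_; _≢_)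
open import Relation.Nullary using (¬_)

open import Data.Nat as ℕ using (suc; _^_; _∸_; NonZero; >-nonZero; s≤s)
import Data.Nat.Properties as ℕ
open import Data.Nat.Coprimality using (1-coprimeTo) renaming (sym to coprime-sym)
open import Data.Nat.DivMod using (m≥n⇒m/n>0)
open import Data.Nat.ListAction.Properties using (∈⇒≤product)
open import Data.Integer as ℤ using (+_)
import Data.Integer.Properties as ℤ
open import Data.Integer.Tactic.RingSolver using (solve-∀)
import Data.Rational as ℚ
open import Data.Rational.Literals using (fromℤ)
import Data.Rational.Properties as ℚ
import Data.Rational.Unnormalised as ℚᵘ
import Data.Rational.Unnormalised.Properties as ℚᵘ
open import Data.List.Membership.Propositional.Properties using (∈-map⁺; ∈-upTo⁺)
open import Data.List.Relation.Unary.All using (universal)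
open import Data.List.Relation.Unary.All.Properties using (map⁺)
open import Relation.Binary.Definitions using (tri<; tri≈; tri>)
open import Relation.Binary.PropositionalEquality using (refl; sym; trans; cong; cong₂; module ≡-Reasoning)
open import Algebra.Bundles using (CommutativeMonoid)
open import Algebra.Properties.CommutativeSemigroup ℕ.+-commutativeSemigroup
  using () renaming (xy∙z≈xz∙y to +-xy∙z≈xz∙y)
open import Algebra.Properties.CommutativeSemigroup (CommutativeMonoid.commutativeSemigroup ℚ.*-1-commutativeMonoid)
  using () renaming (xy∙z≈xz∙y to *-xy∙z≈xz∙y)

*-+-mono-<-balanced : ∀ {a b c d t} → a ℕ.* c ≡ b ℕ.* d → a < b → 0 < t →
                      a ℕ.* (c ℕ.+ t) < b ℕ.* (d ℕ.+ t)
*-+-mono-<-balanced {a} {b} {c} {d} {t} ac≡bd a<b 0<t = begin-strict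
  a ℕ.* (c ℕ.+ t)       ≡⟨ ℕ.*-distribˡ-+ a c t ⟩
  a ℕ.* c ℕ.+ a ℕ.* t   ≡⟨ cong (ℕ._+ a ℕ.* t) ac≡bd ⟩
  b ℕ.* d ℕ.+ a ℕ.* t   <⟨ ℕ.+-monoʳ-< (b ℕ.* d) (ℕ.*-monoˡ-< t {{>-nonZero 0<t}} a<b) ⟩
  b ℕ.* d ℕ.+ b ℕ.* t   ≡⟨ ℕ.*-distribˡ-+ b d t ⟨
  b ℕ.* (d ℕ.+ t)       ∎
  where open ℕ.≤-Reasoning

^-+-*-swap : ∀ q k i j → q ^ (k ℕ.+ i) ℕ.* q ^ j ≡ q ^ (k ℕ.+ j) ℕ.* q ^ i
^-+-*-swap q k i j = begin
  q ^ (k ℕ.+ i) ℕ.* q ^ j   ≡⟨ ℕ.^-distribˡ-+-* q (k ℕ.+ i) j ⟨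
  q ^ (k ℕ.+ i ℕ.+ j)       ≡⟨ cong (q ^_) (+-xy∙z≈xz∙y k i j) ⟩
  q ^ (k ℕ.+ j ℕ.+ i)       ≡⟨ ℕ.^-distribˡ-+-* q (k ℕ.+ j) i ⟩
  q ^ (k ℕ.+ j) ℕ.* q ^ i   ∎
  where open ≡-Reasoning

exponential-cross-< : ∀ {q} k {i j t} → 1 < q → i < j → 0 < t →
  q ^ (k ℕ.+ i) ℕ.* (q ^ j ℕ.+ t) ℕ.+ q ^ (k ∸ j) ℕ.* (q ^ i ℕ.+ t)
    < q ^ (k ℕ.+ j) ℕ.* (q ^ i ℕ.+ t) ℕ.+ q ^ (k ∸ i) ℕ.* (q ^ j ℕ.+ t)
exponential-cross-< {q} k {i} {j} {t} 1<q i<j 0<t =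
  ℕ.+-mono-<-≤
    (*-+-mono-<-balanced (^-+-*-swap q k i j) (ℕ.^-monoʳ-< q 1<q (ℕ.+-monoʳ-< k i<j)) 0<t)
    (ℕ.*-mono-≤ (ℕ.^-monoʳ-≤ q (ℕ.∸-monoʳ-≤ k i≤j)) (ℕ.+-monoˡ-≤ t (ℕ.^-monoʳ-≤ q i≤j)))
  where
  instance _ : NonZero q
           _ = >-nonZero (ℕ.<-trans ℕ.z<s 1<q)
  i≤j : i ≤ j
  i≤j = ℕ.<⇒≤ i<j

-- The conclusion is (u₁ − v₁)(w₂ + t) = (u₂ − v₂)(w₁ + t), rearranged so that no subtraction occurs.
cross-≡⇒ℕ-cross-≡ : ∀ u₁ v₁ w₁ u₂ v₂ w₂ t →
  (+ u₁ ℤ.- + v₁) ℤ.* (ℤ.- + w₂ ℤ.- + t) ≡ (ℤ.- + w₁ ℤ.- + t) ℤ.* (+ u₂ ℤ.- + v₂) →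
  u₁ ℕ.* (w₂ ℕ.+ t) ℕ.+ v₂ ℕ.* (w₁ ℕ.+ t) ≡ u₂ ℕ.* (w₁ ℕ.+ t) ℕ.+ v₁ ℕ.* (w₂ ℕ.+ t)
cross-≡⇒ℕ-cross-≡ u₁ v₁ w₁ u₂ v₂ w₂ t eq = ℤ.+-injective (begin
  + L                 ≡⟨ pos-*-+-* u₁ (w₂ ℕ.+ t) v₂ (w₁ ℕ.+ t) ⟩
  L′                  ≡⟨ rearrange (+ u₁) (+ v₁) (+ w₁) (+ u₂) (+ v₂) (+ w₂) (+ t) ⟩
  R′ ℤ.+ (Q ℤ.- P)    ≡⟨ cong (λ z → R′ ℤ.+ (z ℤ.- P)) eq ⟨
  R′ ℤ.+ (P ℤ.- P)    ≡⟨ cong (λ z → R′ ℤ.+ z) (ℤ.+-inverseʳ P) ⟩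
  R′ ℤ.+ + 0          ≡⟨ ℤ.+-identityʳ R′ ⟩
  R′                  ≡⟨ pos-*-+-* u₂ (w₁ ℕ.+ t) v₁ (w₂ ℕ.+ t) ⟨
  + R                 ∎)
  where
  open ≡-Reasoning
  L = u₁ ℕ.* (w₂ ℕ.+ t) ℕ.+ v₂ ℕ.* (w₁ ℕ.+ t)
  R = u₂ ℕ.* (w₁ ℕ.+ t) ℕ.+ v₁ ℕ.* (w₂ ℕ.+ t)
  L′ = + u₁ ℤ.* (+ w₂ ℤ.+ + t) ℤ.+ + v₂ ℤ.* (+ w₁ ℤ.+ + t)
  R′ = + u₂ ℤ.* (+ w₁ ℤ.+ + t) ℤ.+ + v₁ ℤ.* (+ w₂ ℤ.+ + t)
  P = (+ u₁ ℤ.- + v₁) ℤ.* (ℤ.- + w₂ ℤ.- + t)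
  Q = (ℤ.- + w₁ ℤ.- + t) ℤ.* (+ u₂ ℤ.- + v₂)
  pos-*-+-* : ∀ a b c d → + (a ℕ.* b ℕ.+ c ℕ.* d) ≡ + a ℤ.* + b ℤ.+ + c ℤ.* + d
  pos-*-+-* a b c d = cong₂ ℤ._+_ (ℤ.pos-* a b) (ℤ.pos-* c d)
  rearrange : ∀ U₁ V₁ W₁ U₂ V₂ W₂ T →
    U₁ ℤ.* (W₂ ℤ.+ T) ℤ.+ V₂ ℤ.* (W₁ ℤ.+ T)
      ≡ (U₂ ℤ.* (W₁ ℤ.+ T) ℤ.+ V₁ ℤ.* (W₂ ℤ.+ T))
        ℤ.+ ((ℤ.- W₁ ℤ.- T) ℤ.* (U₂ ℤ.- V₂) ℤ.- (U₁ ℤ.- V₁) ℤ.* (ℤ.- W₂ ℤ.- T))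
  rearrange = solve-∀

*-cancel-scalars : ∀ m n .{{_ : NonZero m}} .{{_ : NonZero n}} (a b c d : ℤ) →
  (+ m ℤ.* a) ℤ.* (+ n ℤ.* b) ≡ (+ m ℤ.* c) ℤ.* (+ n ℤ.* d) → a ℤ.* b ≡ c ℤ.* d
*-cancel-scalars m n a b c d eq =
  ℤ.*-cancelˡ-≡ (+ n) _ _ (ℤ.*-cancelˡ-≡ (+ m) _ _
    (trans (sym (factor-out (+ m) (+ n) a b)) (trans eq (factor-out (+ m) (+ n) c d))))
  where
  factor-out : ∀ M N A B → (M ℤ.* A) ℤ.* (N ℤ.* B) ≡ M ℤ.* (N ℤ.* (A ℤ.* B))
  factor-out = solve-∀

collinear⇒cross-≡ : ∀ {x y x′ y′} t → x ≡ t * x′ → y ≡ t * y′ → x * y′ ≡ y * x′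
collinear⇒cross-≡ {x′ = x′} {y′} t refl refl = *-xy∙z≈xz∙y t x′ y′

/1≡fromℤ : ∀ i → i / 1 ≡ fromℤ i
/1≡fromℤ (+ n)      = ℚ.normalize-coprime (coprime-sym (1-coprimeTo n))
/1≡fromℤ ℤ.-[1+ n ] = cong ℚ.-_ (ℚ.normalize-coprime (coprime-sym (1-coprimeTo (suc n))))

toℚᵘ-/1-* : ∀ a b → ℚ.toℚᵘ ((a / 1) * (b / 1)) ℚᵘ.≃ ℚᵘ.mkℚᵘ (a ℤ.* b) 0
toℚᵘ-/1-* a b rewrite /1≡fromℤ a | /1≡fromℤ b = ℚ.toℚᵘ-homo-* (fromℤ a) (fromℤ b)

/1-*-injective : ∀ a b c d → (a / 1) * (b / 1) ≡ (c / 1) * (d / 1) → a ℤ.* b ≡ c ℤ.* d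
/1-*-injective a b c d eq
  with ℚᵘ.≃-trans (ℚᵘ.≃-sym (toℚᵘ-/1-* a b))
         (ℚᵘ.≃-trans (ℚᵘ.≃-reflexive (cong ℚ.toℚᵘ eq)) (toℚᵘ-/1-* c d))
... | ℚᵘ.*≡* ab≡cd = trans (sym (ℤ.*-identityʳ _)) (trans ab≡cd (ℤ.*-identityʳ _))

scale : ℕ → ℕ → ℕ → ℕ
scale q k j = X q k ℕ./ factor q k j

-- point q k j is definitionally (+ scale q k j) times (direction₁ q k j , direction₂ q k j).
direction₁ direction₂ : ℕ → ℕ → ℕ → ℤ
direction₁ q k j = + (q ^ (k ℕ.+ j)) ℤ.- + (q ^ (k ∸ j))
direction₂ q k j = ℤ.- (+ (q ^ j)) ℤ.- + (2 ℕ.* q ^ k)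

factor≤X : ∀ q k j → 1 ≤ j → j < k → factor q k j ≤ X q k
factor≤X q (suc k) (suc i) _ (s≤s i<k) =
  ∈⇒≤product (map⁺ (universal (λ _ → _) _)) (∈-map⁺ (λ i → factor q (suc k) (suc i)) (∈-upTo⁺ i<k))

0<scale : ∀ q k j → 1 ≤ j → j < k → 0 < scale q k j
0<scale q k j 1≤j j<k = m≥n⇒m/n>0 (factor≤X q k j 1≤j j<k)

directions-not-parallel : ∀ {q} k {i j} → 1 < q → i < j →
  direction₁ q k i ℤ.* direction₂ q k j ≢ direction₂ q k i ℤ.* direction₁ q k j
directions-not-parallel {q} k {i} {j} 1<q i<j eq =
  ℕ.<-irrefl
    (cross-≡⇒ℕ-cross-≡ (q ^ (k ℕ.+ i)) (q ^ (k ∸ i)) (q ^ i)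
                       (q ^ (k ℕ.+ j)) (q ^ (k ∸ j)) (q ^ j) (2 ℕ.* q ^ k) eq)
    (exponential-cross-< k 1<q i<j 0<2qᵏ)
  where
  0<2qᵏ : 0 < 2 ℕ.* q ^ k
  0<2qᵏ = ℕ.≤-trans (ℕ.m^n>0 q {{>-nonZero (ℕ.<-trans ℕ.z<s 1<q)}} k) (ℕ.m≤m+n _ _)

distinct-directions-not-parallel : ∀ {q} k {i j} → 1 < q → i ≢ j →
  direction₁ q k i ℤ.* direction₂ q k j ≢ direction₂ q k i ℤ.* direction₁ q k j
distinct-directions-not-parallel {q} k {i} {j} 1<q i≢j eq with ℕ.<-cmp i j
... | tri< i<j _ _ = directions-not-parallel k 1<q i<j eq
... | tri≈ _ i≡j _ = i≢j i≡j
... | tri> _ _ j<i = directions-not-parallel k 1<q j<i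
                       (swap (direction₁ q k i) (direction₂ q k j) (direction₂ q k i) (direction₁ q k j) eq)
  where
  swap : ∀ a b c d → a ℤ.* b ≡ c ℤ.* d → d ℤ.* c ≡ b ℤ.* a
  swap a b c d e = trans (ℤ.*-comm d c) (trans (sym e) (ℤ.*-comm a b))

lemma5 : (q k : ℕ) → 2 ≤ q → 2 ≤ k →
         (i j : ℕ) → 1 ≤ i → i < k → 1 ≤ j → j < k →
         point q k i ≢ point q k j →
         ¬ (∃[ t ] ((proj₁ (point q k i) / 1 ≡ t * (proj₁ (point q k j) / 1))
                  × (proj₂ (point q k i) / 1 ≡ t * (proj₂ (point q k j) / 1))))
lemma5 q k 1<q _ i j 1≤i i<k 1≤j j<k pᵢ≢pⱼ (t , x≡ , y≡) =
  distinct-directions-not-parallel k {i} {j} 1<q (λ { refl → pᵢ≢pⱼ refl }) parallel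
  where
  instance
    _ : NonZero (scale q k i)
    _ = >-nonZero (0<scale q k i 1≤i i<k)
    _ : NonZero (scale q k j)
    _ = >-nonZero (0<scale q k j 1≤j j<k)
  parallel : direction₁ q k i ℤ.* direction₂ q k j ≡ direction₂ q k i ℤ.* direction₁ q k j
  parallel = *-cancel-scalars (scale q k i) (scale q k j)
    (direction₁ q k i) (direction₂ q k j) (direction₂ q k i) (direction₁ q k j)
    (/1-*-injective (proj₁ (point q k i)) (proj₂ (point q k j)) (proj₂ (point q k i)) (proj₁ (point q k j))
      (collinear⇒cross-≡ t x≡ y≡))
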